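{- Let $\Gamma$ be a coloring and $\Omega$ a $k$-ordering of $T_{d,k}$, with initial $d$-cell $\mathcal T$. For every $d$-cell $\tau$ of $T_{d,k}$ and every cell $\rho\subseteq\tau$, $$L_{\rho,\tau}=K_{[\![d]\!]\setminus\Gamma(\rho)}.$$ In particular $L_{\rho,\tau}$ depends only on the color of $\rho$.
   Context: $[\![d]\!]=\{0,\dots,d\}$. $G_{d,k}=\langle\alpha_0,\dots,\alpha_d\mid\alpha_i^k=e\rangle$; for $J\subseteq[\![d]\!]$, $K_J=\langle\alpha_j:j\in J\rangle$. Arboreal complex $T_{d,k}$: $B_0$ a single $d$-cell $\mathcal T$ with its faces; $B_{n+1}$ obtained from $B_n$ by attaching to each $(d-1)$-cell of $B_n$ contained in exactly one $d$-cell of $B_n$ $k-1$ new $d$-cells, each using a new vertex; $T_{d,k}=\bigcup_nB_n$ (every $(d-1)$-cell then lies in exactly $k$ $d$-cells). A coloring $\Gamma:T^0_{d,k}\to[\![d]\!]$ is injective on each $d$-cell; $\Gamma(\rho)=\{\Gamma(v):v\in\rho\}$. A $k$-ordering $\Omega$ assigns to each $(d-1)$-cell $\sigma$ a transitive homomorphism $\Omega_\sigma:C_k\to\mathcal S_{\delta(\sigma)}$, $\delta(\sigma)$ the set of $d$-cells containing $\sigma$, $C_k$ cyclic of order $k$. $G_{d,k}$ acts on the left on $d$-cells: $\alpha_i^l.\tau=\Omega_\sigma(\alpha_i^l).\tau$ where $\sigma$ is the $(d-1)$-cell of $\tau$ of color $[\![d]\!]\setminus\{i\}$ (identifying $C_k$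 with $\langle\alpha_i\rangle$), extended to words (this is a well-defined action). For $\rho\subseteq\tau$ with $\tau$ a $d$-cell, define $g.(\rho,\tau)=(\rho',g.\tau)$ with $\rho'$ the unique cell of $g.\tau$ of color $\Gamma(\rho)$, and $L_{\rho,\tau}=\{g\in G_{d,k}:g.(\rho,\tau)=(\rho,g.\tau)\}$. -}

module Defs where

open import Data.Nat using (ℕ; zero; suc; _+_; _∸_; _%_)
open import Data.Nat.DivMod using (m%n<n)
open import Data.Fin using (Fin; toℕ; fromℕ<; _≟_)
open import Data.Fin.Properties using (any?)
open import Data.Fin.Subset using (Subset; _∈_)
open import Data.Maybe using (Maybe; just; nothing)
open import Data.List using (List; []; _∷_; _++_)
open import Data.List.Relation.Unary.All using (All)
open import Data.Product using (Σ; ∃; ∃-syntax; _×_; _,_; proj₁; proj₂)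
open import Data.Unit using (⊤)
open import Relation.Nullary using (¬_; yes; no)
open import Relation.Binary.PropositionalEquality using (_≡_; _≢_)
open import Relation.Binary.Construct.Closure.Equivalence using (EqClosure)
open import Function.Bundles using (_↔_; Inverse; _⇔_)

_+ₖ_ : ∀ {n} → Fin n → Fin n → Fin n
_+ₖ_ {suc n} a b = fromℕ< (m%n<n (toℕ a + toℕ b) (suc n))

module TDK (d k : ℕ) where

  -- colors / positions: [[d]] = Fin (suc d)
  Col : Set
  Col = Fin (suc d)

  -- A d-cell is encoded by its path from the initial cell 𝒯 = [] :
  -- a list of steps (p , c), most recent first.  The step (p , c)
  -- attaches the c-th (c < k-1) new d-cell along the (d-1)-face of the
  -- current cell opposite its vertex in position p; the new cell
  -- replaces that vertex (position p) by a new vertex.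
  Step : Set
  Step = Col × Fin (k ∸ 1)

  Cell : Set
  Cell = List Step

  -- a path is an actual d-cell iff consecutive positions differ
  -- (the face opposite the new vertex is not free)
  ValidCell : Cell → Set
  ValidCell []               = ⊤
  ValidCell (s ∷ [])         = ⊤
  ValidCell (s ∷ s' ∷ ps)    = (proj₁ s ≢ proj₁ s') × ValidCell (s' ∷ ps)

  -- A vertex (j , ps): the vertex in position j introduced by the
  -- cell ps (ps = [] : vertex j of the initial cell 𝒯).
  Vertex : Set
  Vertex = Col × Cell

  dropTo : Col → Cell → Cell
  dropTo j [] = []
  dropTo j (s ∷ ps) with proj₁ s ≟ j
  ... | yes _ = s ∷ ps
  ... | no  _ = dropTo j ps

  vertexAt : Cell → Col → Vertex
  vertexAt τ j = (j , dropTo j τ)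

  -- (d-1)-cells.  The (d-1)-face of τ opposite position p is encoded by
  -- (p , strip p τ); δ(σ) for σ = (p , b) is encoded by
  -- Maybe (Fin (k ∸ 1)) : nothing ↦ b, just c ↦ (p , c) ∷ b.
  strip : Col → Cell → Cell
  strip p [] = []
  strip p (s ∷ ps) with proj₁ s ≟ p
  ... | yes _ = ps
  ... | no  _ = s ∷ ps

  Delta : Set
  Delta = Maybe (Fin (k ∸ 1))

  member : Col → Cell → Delta → Cell
  member p b nothing  = b
  member p b (just c) = (p , c) ∷ b

  indexIn : Col → Cell → Delta
  indexIn p [] = nothing
  indexIn p (s ∷ ps) with proj₁ s ≟ p
  ... | yes _ = just (proj₂ s)
  ... | no  _ = nothing

  record Coloring : Set where
    field
      col : Vertex → Col
      inj : ∀ τ → ValidCell τ → ∀ i j →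
            col (vertexAt τ i) ≡ col (vertexAt τ j) → i ≡ j

  record TransHom : Set where
    field
      act   : Fin k → (Delta ↔ Delta)
      hom   : ∀ a b x → Inverse.to (act (a +ₖ b)) x
                        ≡ Inverse.to (act a) (Inverse.to (act b) x)
      trans : ∀ x y → ∃[ a ] Inverse.to (act a) x ≡ y

  -- k-ordering: one transitive homomorphism for every (d-1)-cell (p , b)
  KOrdering : Set
  KOrdering = Col → Cell → TransHom

  -- The group G_{d,k}: words in syllables α_i^l (l ∈ C_k = Fin k),
  -- modulo the congruence generated by α_i^a α_i^b = α_i^(a+b), α_i^0 = e.
  Word : Set
  Word = List (Col × Fin k)

  data Red : Word → Word → Set where
    merge : ∀ u v i a b → Red (u ++ (i , a) ∷ (i , b) ∷ v) (u ++ (i , a +ₖ b) ∷ v)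
    unit  : ∀ u v i (z : Fin k) → toℕ z ≡ 0 → Red (u ++ (i , z) ∷ v) (u ++ v)

  _≈G_ : Word → Word → Set
  _≈G_ = EqClosure Red

  -- K_J for J ⊆ [[d]] : the subgroup generated by the α_j, j ∈ J
  InK : (Col → Set) → Word → Set
  InK J w = ∃[ w' ] (All (λ s → J (proj₁ s)) w' × (w ≈G w'))

  module _ (Γ : Coloring) (Ω : KOrdering) where
    open Coloring Γ

    -- position of the vertex of τ of color i (exists by injectivity)
    findPos : Cell → Col → Maybe Col
    findPos τ i with any? (λ p → col (vertexAt τ p) ≟ i)
    ... | yes (p , _) = just p
    ... | no  _       = nothing

    -- α_i^l . τ = Ω_σ(l) . τ, σ the (d-1)-face of τ of color [[d]] ∖ {i}
    actSyl : Col × Fin k → Cell → Cell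
    actSyl (i , l) τ with findPos τ i
    ... | nothing = τ
    ... | just p  = member p (strip p τ)
                      (Inverse.to (TransHom.act (Ω p (strip p τ)) l) (indexIn p τ))

    actW : Word → Cell → Cell
    actW []      τ = τ
    actW (s ∷ w) τ = actSyl s (actW w τ)

    -- the cell ρ ⊆ τ with position set S, its vertices and colors
    InCell : Cell → Subset (suc d) → Vertex → Set
    InCell τ S v = ∃[ j ] (j ∈ S × vertexAt τ j ≡ v)

    ColorOf : Cell → Subset (suc d) → Col → Set
    ColorOf τ S i = ∃[ j ] (j ∈ S × col (vertexAt τ j) ≡ i)

    CellOfColor : Cell → (Col → Set) → Vertex → Set
    CellOfColor τ' C v = ∃[ j ] (C (col (vertexAt τ' j)) × vertexAt τ' j ≡ v)

    -- g ∈ L_{ρ,τ}  iff  the cell of g.τ of color Γ(ρ) is ρ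
    InL : Cell → Subset (suc d) → Word → Set
    InL τ S g = ∀ v → InCell τ S v ⇔ CellOfColor (actW g τ) (ColorOf τ S) v

module Submission where

-- The syllable α_i^l only replaces the vertex of colour i, and along the orbit of τ each colour stays
-- in a fixed position of the path encoding, so K_J fixes ρ whenever J avoids Γ(ρ). Conversely, write g
-- as a reduced word. Since C_k acts freely on every δ(σ) and the d-cells form a tree, the gallery from
-- τ to g.τ traced by a reduced word is a geodesic: τ and g.τ descend from their meet along disjoint
-- branches, so every vertex whose colour occurs in the word is replaced. Hence g fixes ρ only if the
-- word avoids Γ(ρ).

open import Defs
open import Data.Nat using (ℕ; suc; _≤_; s≤s)
open import Data.Nat.Properties using (1+n≰n; ≤-refl; ≤-trans; ≤-reflexive; n≤1+n)
open import Data.Fin using (Fin; zero; suc; _≟_; punchOut; toℕ)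
open import Data.Fin.Properties using (any?; punchOut-injective; injective⇒≤; toℕ-injective)
open import Data.Fin.Subset using (Subset; _∈_)
open import Data.Maybe as Maybe using (Maybe; just; nothing)
open import Data.Maybe.Properties using (just-injective)
open import Data.List using (List; []; _∷_; _++_; _∷ʳ_; head; last; length; map)
open import Data.List.Properties using (++-assoc; ++-cancelʳ; length-++-≤ʳ)
open import Data.List.Relation.Unary.All as All using (All; []; _∷_)
open import Data.List.Relation.Unary.All.Properties as AllP using ()
open import Data.List.Relation.Unary.Any.Properties as AnyP using ()
open import Data.List.Relation.Unary.Any as Any using (Any; here; there)
open import Data.Product as Product using (∃; ∃-syntax; _×_; _,_; proj₁; proj₂; map₁)
open import Data.Sum as Sum using (_⊎_; inj₁; inj₂; [_,_]′)
open import Data.Unit using (⊤; tt)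
open import Function.Base using (_∘_)
open import Function.Bundles using (Inverse; Equivalence; _⇔_; mk⇔)
open import Function.Definitions using (Injective)
open import Relation.Nullary using (¬_; yes; no; contradiction)
open import Relation.Binary.PropositionalEquality
open import Relation.Binary.Construct.Closure.Equivalence as EqClosure using ()
open import Relation.Binary.Construct.Closure.ReflexiveTransitive using (ε; _◅◅_)

Fin-injective⇒surjective : ∀ {n} {f : Fin n → Fin n} → Injective _≡_ _≡_ f → ∀ y → ∃[ x ] f x ≡ y
Fin-injective⇒surjective {suc _} {f} f-inj y with any? (λ x → f x ≟ y)
... | yes found = found
... | no ∄x = contradiction (injective⇒≤ punchOut∘f-injective) 1+n≰n
  where
  y≢f : ∀ x → y ≢ f x
  y≢f x y≡fx = ∄x (x , sym y≡fx)
  punchOut∘f-injective : Injective _≡_ _≡_ (λ x → punchOut (y≢f x))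
  punchOut∘f-injective = f-inj ∘ punchOut-injective (y≢f _) (y≢f _)

Fin-surjective⇒injective : ∀ {n} {f : Fin n → Fin n} → (∀ y → ∃[ x ] f x ≡ y) → Injective _≡_ _≡_ f
Fin-surjective⇒injective {n} {f} f-onto {a} {b} fa≡fb = begin
    a          ≡⟨ sym (proj₂ a-section) ⟩
    section ya ≡⟨ cong section ya≡yb ⟩
    section yb ≡⟨ proj₂ b-section ⟩
    b          ∎
  where
  open ≡-Reasoning
  section : Fin n → Fin n
  section y = proj₁ (f-onto y)
  f∘section : ∀ y → f (section y) ≡ y
  f∘section y = proj₂ (f-onto y)
  section-injective : Injective _≡_ _≡_ section
  section-injective {y} {y'} e = trans (sym (f∘section y)) (trans (cong f e) (f∘section y'))
  a-section = Fin-injective⇒surjective section-injective a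
  b-section = Fin-injective⇒surjective section-injective b
  ya = proj₁ a-section
  yb = proj₁ b-section
  ya≡yb : ya ≡ yb
  ya≡yb = begin
    ya              ≡⟨ sym (f∘section ya) ⟩
    f (section ya)  ≡⟨ cong f (proj₂ a-section) ⟩
    f a             ≡⟨ fa≡fb ⟩
    f b             ≡⟨ cong f (sym (proj₂ b-section)) ⟩
    f (section yb)  ≡⟨ f∘section yb ⟩
    yb              ∎

maybeToFin : ∀ {n} → Maybe (Fin n) → Fin (suc n)
maybeToFin nothing  = zero
maybeToFin (just i) = suc i

finToMaybe : ∀ {n} → Fin (suc n) → Maybe (Fin n)
finToMaybe zero    = nothing
finToMaybe (suc i) = just i

maybeToFin∘finToMaybe : ∀ {n} (i : Fin (suc n)) → maybeToFin (finToMaybe i) ≡ i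
maybeToFin∘finToMaybe zero    = refl
maybeToFin∘finToMaybe (suc i) = refl

last-∷ʳ : ∀ {a} {A : Set a} (xs : List A) (x : A) → last (xs ∷ʳ x) ≡ just x
last-∷ʳ []           x = refl
last-∷ʳ (y ∷ [])     x = refl
last-∷ʳ (y ∷ z ∷ xs) x = last-∷ʳ (z ∷ xs) x

last-∷ : ∀ {a p} {A : Set a} {P : A → Set p} (x : A) {xs} → Any P xs → last (x ∷ xs) ≡ last xs
last-∷ x {_ ∷ _} _ = refl

last-∷≢nothing : ∀ {a} {A : Set a} (x : A) xs → last (x ∷ xs) ≢ nothing
last-∷≢nothing x []       ()
last-∷≢nothing x (y ∷ xs) = last-∷≢nothing y xs

last-Any : ∀ {a p} {A : Set a} {P : A → Set p} {xs} → Any P xs → last xs ≢ nothing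
last-Any {xs = x ∷ xs} _ = last-∷≢nothing x xs

module TransitiveAction {d n : ℕ} (ω : TDK.TransHom d (suc n)) where
  open TDK d (suc n) using (Delta)
  open TDK.TransHom ω renaming (trans to transitive)
  open ≡-Reasoning

  rotate : Fin (suc n) → Delta → Delta
  rotate l = Inverse.to (act l)

  rotate-zero : ∀ x → rotate zero x ≡ x
  rotate-zero x = begin
    rotate zero x                      ≡⟨ strictlyInverseʳ (rotate zero x) ⟨
    from (rotate zero (rotate zero x)) ≡⟨ cong from (hom zero zero x) ⟨
    from (rotate zero x)               ≡⟨ strictlyInverseʳ x ⟩
    x                                  ∎
    where open Inverse (act zero) using (from; strictlyInverseʳ)

  -- The orbit map of x is onto the k-element set δ(σ), hence injective.
  rotate-free : ∀ l x → rotate l x ≡ x → l ≡ zero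
  rotate-free l x fixed =
    Fin-surjective⇒injective orbit-onto (cong maybeToFin (trans fixed (sym (rotate-zero x))))
    where
    orbit : Fin (suc n) → Fin (suc n)
    orbit a = maybeToFin (rotate a x)
    orbit-onto : ∀ y → ∃[ a ] orbit a ≡ y
    orbit-onto y with a , e ← transitive x (finToMaybe y) =
      a , trans (cong maybeToFin e) (maybeToFin∘finToMaybe y)

At : ∀ {n} {A : Set} → Fin n → Fin n × A → Set
At p s = proj₁ s ≡ p

Any-At : ∀ {n} {A : Set} {P : Fin n → Set} {xs : List (Fin n × A)} →
         Any (P ∘ proj₁) xs → ∃[ j ] P j × Any (At j) xs
Any-At (here p)    = _ , p , here refl
Any-At (there hit) = Product.map₂ (Product.map₂ there) (Any-At hit)

module Paths (d k : ℕ) where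
  open TDK d k

  -- σ is the member `nothing` of δ of its face opposite p, i.e. it was not entered across that face.
  HeadAvoids : Col → Cell → Set
  HeadAvoids p []      = ⊤
  HeadAvoids p (s ∷ _) = proj₁ s ≢ p

  strip-here : ∀ p c σ → strip p ((p , c) ∷ σ) ≡ σ
  strip-here p c σ with p ≟ p
  ... | yes _   = refl
  ... | no p≢p = contradiction refl p≢p

  strip-fresh : ∀ p σ → HeadAvoids p σ → strip p σ ≡ σ
  strip-fresh p []            _   = refl
  strip-fresh p ((q , c) ∷ σ) q≢p with q ≟ p
  ... | yes q≡p = contradiction q≡p q≢p
  ... | no _    = refl

  indexIn-here : ∀ p c σ → indexIn p ((p , c) ∷ σ) ≡ just c
  indexIn-here p c σ with p ≟ p
  ... | yes _   = refl
  ... | no p≢p = contradiction refl p≢p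

  indexIn-fresh : ∀ p σ → HeadAvoids p σ → indexIn p σ ≡ nothing
  indexIn-fresh p []            _   = refl
  indexIn-fresh p ((q , c) ∷ σ) q≢p with q ≟ p
  ... | yes q≡p = contradiction q≡p q≢p
  ... | no _    = refl

  strip-member : ∀ p σ x → HeadAvoids p σ → strip p (member p σ x) ≡ σ
  strip-member p σ nothing  fresh = strip-fresh p σ fresh
  strip-member p σ (just c) _     = strip-here p c σ

  indexIn-member : ∀ p σ x → HeadAvoids p σ → indexIn p (member p σ x) ≡ x
  indexIn-member p σ nothing  fresh = indexIn-fresh p σ fresh
  indexIn-member p σ (just c) _     = indexIn-here p c σ

  member-strip : ∀ p σ → member p (strip p σ) (indexIn p σ) ≡ σ
  member-strip p []            = refl
  member-strip p ((q , c) ∷ σ) with q ≟ p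
  ... | yes refl = refl
  ... | no _     = refl

  strip-valid : ∀ p σ → ValidCell σ → ValidCell (strip p σ) × HeadAvoids p (strip p σ)
  strip-valid p []                          _            = tt , tt
  strip-valid p ((q , c) ∷ [])              _            with q ≟ p
  ... | yes _   = tt , tt
  ... | no q≢p = tt , q≢p
  strip-valid p ((q , c) ∷ (q' , c') ∷ σ) (q≢q' , valid) with q ≟ p
  ... | yes refl = valid , q≢q' ∘ sym
  ... | no q≢p   = (q≢q' , valid) , q≢p

  member-valid : ∀ p σ x → ValidCell σ → HeadAvoids p σ → ValidCell (member p σ x)
  member-valid p σ       nothing  valid _     = valid
  member-valid p []      (just c) _     _     = tt
  member-valid p (s ∷ σ) (just c) valid s≢p = s≢p ∘ sym , valid

  dropTo-member : ∀ q p σ x → q ≢ p → dropTo q (member p σ x) ≡ dropTo q σ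
  dropTo-member q p σ nothing  _   = refl
  dropTo-member q p σ (just c) q≢p with p ≟ q
  ... | yes p≡q = contradiction (sym p≡q) q≢p
  ... | no _    = refl

  dropTo-strip : ∀ q p σ → q ≢ p → dropTo q (strip p σ) ≡ dropTo q σ
  dropTo-strip q p []            _   = refl
  dropTo-strip q p ((r , c) ∷ σ) q≢p with r ≟ p
  ... | no _    = refl
  ... | yes refl with r ≟ q
  ...   | yes r≡q = contradiction (sym r≡q) q≢p
  ...   | no _    = refl

  length-dropTo : ∀ j σ → length (dropTo j σ) ≤ length σ
  length-dropTo j []            = ≤-refl
  length-dropTo j ((q , c) ∷ σ) with q ≟ j
  ... | yes _ = ≤-refl
  ... | no _  = ≤-trans (length-dropTo j σ) (n≤1+n _)

  dropTo-++ˡ : ∀ j u z → Any (At j) u → dropTo j (u ++ z) ≡ dropTo j u ++ z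
  dropTo-++ˡ j ((q , c) ∷ u) z hit with q ≟ j
  ... | yes _   = refl
  ... | no q≢j = dropTo-++ˡ j u z (Any.tail q≢j hit)

  dropTo-++ʳ : ∀ j u z → ¬ Any (At j) u → dropTo j (u ++ z) ≡ dropTo j z
  dropTo-++ʳ j []            z _    = refl
  dropTo-++ʳ j ((q , c) ∷ u) z miss with q ≟ j
  ... | yes q≡j = contradiction (here q≡j) miss
  ... | no _    = dropTo-++ʳ j u z (miss ∘ there)

  last-dropTo : ∀ j u → Any (At j) u → last (dropTo j u) ≡ last u
  last-dropTo j ((q , c) ∷ u) hit with q ≟ j
  ... | yes _   = refl
  ... | no q≢j = trans (last-dropTo j u hit′) (sym (last-∷ (q , c) hit′))
    where hit′ = Any.tail q≢j hit

  dropTo-++-≢ : ∀ j u z → Any (At j) u → dropTo j (u ++ z) ≢ dropTo j z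
  dropTo-++-≢ j ((q , c) ∷ u) z hit with q ≟ j
  ... | no q≢j = dropTo-++-≢ j u z (Any.tail q≢j hit)
  ... | yes _  = λ e → 1+n≰n (≤-trans (≤-reflexive (cong length e))
                               (≤-trans (length-dropTo j z) (length-++-≤ʳ z {u})))

  DistinctEnds : Cell → Cell → Set
  DistinctEnds u w = last u ≡ last w → last u ≡ nothing

  -- u ++ z and w ++ z leave their common ancestor z along different branches, so a vertex
  -- introduced on either branch is not shared.
  dropTo-separates : ∀ j u w z → DistinctEnds u w → Any (At j) u ⊎ Any (At j) w →
                     dropTo j (u ++ z) ≢ dropTo j (w ++ z)
  dropTo-separates j u w z distinct visited same
    with Any.any? (λ s → proj₁ s ≟ j) u | Any.any? (λ s → proj₁ s ≟ j) w
  ... | yes inU | yes inW = last-Any inU (distinct (begin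
        last u                ≡⟨ sym (last-dropTo j u inU) ⟩
        last (dropTo j u)     ≡⟨ cong last (++-cancelʳ z _ _ dropTo-u≡dropTo-w) ⟩
        last (dropTo j w)     ≡⟨ last-dropTo j w inW ⟩
        last w                ∎))
    where
    open ≡-Reasoning
    dropTo-u≡dropTo-w : dropTo j u ++ z ≡ dropTo j w ++ z
    dropTo-u≡dropTo-w = trans (sym (dropTo-++ˡ j u z inU)) (trans same (dropTo-++ˡ j w z inW))
  ... | yes inU | no ∉w = dropTo-++-≢ j u z inU (trans same (dropTo-++ʳ j w z ∉w))
  ... | no ∉u | yes inW = dropTo-++-≢ j w z inW (trans (sym same) (dropTo-++ʳ j u z ∉u))
  ... | no ∉u | no ∉w = [ ∉u , ∉w ]′ visited

module Words (d n : ℕ) where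
  open TDK d (suc n)

  headLetter : Word → Maybe Col
  headLetter w = Maybe.map proj₁ (head w)

  Reduced : Word → Set
  Reduced []             = ⊤
  Reduced ((i , l) ∷ w) = l ≢ zero × headLetter w ≢ just i × Reduced w

  relabel : (Col → Col) → Word → Word
  relabel f = map (map₁ f)

  relabel-reduced : ∀ {f} → Injective _≡_ _≡_ f → ∀ w → Reduced w → Reduced (relabel f w)
  relabel-reduced         f-inj []            _                       = tt
  relabel-reduced {f = f} f-inj ((i , l) ∷ w) (l≢0 , w≢i , reduced) =
    l≢0 , head≢ w w≢i , relabel-reduced f-inj w reduced
    where
    head≢ : ∀ w → headLetter w ≢ just i → headLetter (relabel f w) ≢ just (f i)
    head≢ []            _   ()
    head≢ ((j , _) ∷ _) j≢i e = j≢i (cong just (f-inj (just-injective e)))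

  ≈G-cons : ∀ s {w w′} → w ≈G w′ → (s ∷ w) ≈G (s ∷ w′)
  ≈G-cons s = EqClosure.gmap (s ∷_) cons-red
    where
    cons-red : ∀ {w w′} → Red w w′ → Red (s ∷ w) (s ∷ w′)
    cons-red (merge u v i a b) = merge (s ∷ u) v i a b
    cons-red (unit u v i z z≡0) = unit (s ∷ u) v i z z≡0

  push : Col × Fin (suc n) → Word → Word
  push (i , a) [] with a ≟ zero
  ... | yes _ = []
  ... | no _  = (i , a) ∷ []
  push (i , a) ((j , b) ∷ w) with i ≟ j
  ... | yes _ = push (i , a +ₖ b) w
  ... | no _ with a ≟ zero
  ...   | yes _ = (j , b) ∷ w
  ...   | no _  = (i , a) ∷ (j , b) ∷ w

  normalise : Word → Word
  normalise []      = []
  normalise (s ∷ w) = push s (normalise w)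

  push-reduced : ∀ s w → Reduced w → Reduced (push s w)
  push-reduced (i , a) [] _ with a ≟ zero
  ... | yes _  = tt
  ... | no a≢0 = a≢0 , (λ ()) , tt
  push-reduced (i , a) ((j , b) ∷ w) reduced with i ≟ j
  ... | yes _  = push-reduced (i , a +ₖ b) w (proj₂ (proj₂ reduced))
  ... | no i≢j with a ≟ zero
  ...   | yes _  = reduced
  ...   | no a≢0 = a≢0 , i≢j ∘ sym ∘ just-injective , reduced

  normalise-reduced : ∀ w → Reduced (normalise w)
  normalise-reduced []      = tt
  normalise-reduced (s ∷ w) = push-reduced s (normalise w) (normalise-reduced w)

  push-≈G : ∀ s w → (s ∷ w) ≈G push s w
  push-≈G (i , a) [] with a ≟ zero
  ... | yes a≡0 = EqClosure.return (unit [] [] i a (cong toℕ a≡0))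
  ... | no _    = ε
  push-≈G (i , a) ((j , b) ∷ w) with i ≟ j
  ... | yes refl = EqClosure.return (merge [] w i a b) ◅◅ push-≈G (i , a +ₖ b) w
  ... | no _ with a ≟ zero
  ...   | yes a≡0 = EqClosure.return (unit [] ((j , b) ∷ w) i a (cong toℕ a≡0))
  ...   | no _    = ε

  normalise-≈G : ∀ w → w ≈G normalise w
  normalise-≈G []      = ε
  normalise-≈G (s ∷ w) = ≈G-cons s (normalise-≈G w) ◅◅ push-≈G s (normalise w)

module Steps {d n : ℕ} (Ω : TDK.KOrdering d (suc n)) where
  open TDK d (suc n)
  open Paths d (suc n)
  open Words d n
  open ≡-Reasoning

  rotate : Col → Cell → Fin (suc n) → Delta → Delta
  rotate p b = TransitiveAction.rotate (Ω p b)

  step : Col → Fin (suc n) → Cell → Cell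
  step p l σ = member p (strip p σ) (rotate p (strip p σ) l (indexIn p σ))

  steps : Word → Cell → Cell
  steps []            σ = σ
  steps ((p , l) ∷ w) σ = step p l (steps w σ)

  step-unfold : ∀ p l σ {b x} → strip p σ ≡ b → indexIn p σ ≡ x → step p l σ ≡ member p b (rotate p b l x)
  step-unfold p l σ refl refl = refl

  step-valid : ∀ p l σ → ValidCell σ → ValidCell (step p l σ)
  step-valid p l σ valid = member-valid p (strip p σ) _ (proj₁ stripped) (proj₂ stripped)
    where stripped = strip-valid p σ valid

  dropTo-step : ∀ q p l σ → q ≢ p → dropTo q (step p l σ) ≡ dropTo q σ
  dropTo-step q p l σ q≢p =
    trans (dropTo-member q p (strip p σ) (rotate p (strip p σ) l (indexIn p σ)) q≢p) (dropTo-strip q p σ q≢p)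

  step-zero : ∀ p σ → step p zero σ ≡ σ
  step-zero p σ = trans (cong (member p (strip p σ)) (TransitiveAction.rotate-zero (Ω p (strip p σ)) (indexIn p σ)))
                        (member-strip p σ)

  step-merge : ∀ p a b σ → ValidCell σ → step p a (step p b σ) ≡ step p (a +ₖ b) σ
  step-merge p a b σ valid = begin
    step p a (member p b₀ y)       ≡⟨ step-unfold p a (member p b₀ y) (strip-member p b₀ y fresh)
                                                                       (indexIn-member p b₀ y fresh) ⟩
    member p b₀ (rotate p b₀ a y)  ≡⟨ cong (member p b₀) (sym (TransHom.hom (Ω p b₀) a b x)) ⟩
    step p (a +ₖ b) σ              ∎
    where
    b₀ = strip p σ
    x = indexIn p σ
    y = rotate p b₀ b x
    fresh = proj₂ (strip-valid p σ valid)

  steps-fix : ∀ j w σ → All (¬_ ∘ At j) w → dropTo j (steps w σ) ≡ dropTo j σ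
  steps-fix j []            σ []                = refl
  steps-fix j ((p , l) ∷ w) σ (p≢j ∷ avoids) =
    trans (dropTo-step j p l (steps w σ) (p≢j ∘ sym)) (steps-fix j w σ avoids)

  step-into-child : ∀ q l σ → l ≢ zero → HeadAvoids q σ → ∃[ c ] step q l σ ≡ (q , c) ∷ σ
  step-into-child q l σ l≢0 fresh with rotate q σ l nothing in e
  ... | nothing = contradiction (TransitiveAction.rotate-free (Ω q σ) l nothing e) l≢0
  ... | just c  = c , trans unfolded (cong (member q σ) e)
    where unfolded = step-unfold q l σ (strip-fresh q σ fresh) (indexIn-fresh q σ fresh)

  step-out-of-child : ∀ q l c σ → l ≢ zero →
    step q l ((q , c) ∷ σ) ≡ σ ⊎ ∃[ c′ ] c′ ≢ c × step q l ((q , c) ∷ σ) ≡ (q , c′) ∷ σ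
  step-out-of-child q l c σ l≢0 with rotate q σ l (just c) in e
  ... | nothing = inj₁ (trans unfolded (cong (member q σ) e))
    where unfolded = step-unfold q l ((q , c) ∷ σ) (strip-here q c σ) (indexIn-here q c σ)
  ... | just c′ = inj₂ (c′ , c′≢c , trans unfolded (cong (member q σ) e))
    where
    unfolded = step-unfold q l ((q , c) ∷ σ) (strip-here q c σ) (indexIn-here q c σ)
    c′≢c : c′ ≢ c
    c′≢c refl = l≢0 (TransitiveAction.rotate-free (Ω q σ) l (just c) e)

  frontier : Cell → Cell → Maybe Col
  frontier u []      = Maybe.map proj₁ (last u)
  frontier _ (y ∷ _) = just (proj₁ y)

  distinct-∷ : ∀ {u} t w → frontier u w ≢ just (proj₁ t) → DistinctEnds u w → DistinctEnds u (t ∷ w)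
  distinct-∷ t []      u≢t _        same = contradiction (cong (Maybe.map proj₁) same) u≢t
  distinct-∷ t (_ ∷ _) _   distinct = distinct

  Visits : Col → Cell → Cell → Set
  Visits j u w = Any (At j) u ⊎ Any (At j) w

  record Move (q : Col) (l : Fin (suc n)) (u w z : Cell) : Set where
    field
      u′ w′ z′   : Cell
      same-start : u ++ z ≡ u′ ++ z′
      stepped    : step q l (w ++ z) ≡ w′ ++ z′
      distinct′  : DistinctEnds u′ w′
      front′     : frontier u′ w′ ≡ just q
      revisits   : ∀ {j} → Visits j u w → Visits j u′ w′
      visits-q   : Visits q u′ w′

  enter-child : ∀ q l u w z → l ≢ zero → HeadAvoids q (w ++ z) → frontier u w ≢ just q →
                DistinctEnds u w → Move q l u w z
  enter-child q l u w z l≢0 fresh u,w≢q distinct with c , e ← step-into-child q l (w ++ z) l≢0 fresh = record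
    { u′ = u ; w′ = (q , c) ∷ w ; z′ = z
    ; same-start = refl ; stepped = e
    ; distinct′ = distinct-∷ (q , c) w u,w≢q distinct ; front′ = refl
    ; revisits = Sum.map₂ there ; visits-q = inj₂ (here refl) }

  leave-child : ∀ q l c u z → l ≢ zero → Move q l u [] ((q , c) ∷ z)
  leave-child q l c u z l≢0 with step-out-of-child q l c z l≢0
  ... | inj₁ e = record
    { u′ = u ∷ʳ (q , c) ; w′ = [] ; z′ = z
    ; same-start = sym (++-assoc u _ z) ; stepped = e
    ; distinct′ = λ same → same ; front′ = cong (Maybe.map proj₁) (last-∷ʳ u (q , c))
    ; revisits = λ { (inj₁ hit) → inj₁ (AnyP.++⁺ˡ hit) } ; visits-q = inj₁ (AnyP.++⁺ʳ u (here refl)) }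
  ... | inj₂ (c′ , c′≢c , e) = record
    { u′ = u ∷ʳ (q , c) ; w′ = (q , c′) ∷ [] ; z′ = z
    ; same-start = sym (++-assoc u _ z) ; stepped = e
    ; distinct′ = λ same →
        contradiction (sym (cong proj₂ (just-injective (trans (sym (last-∷ʳ u _)) same)))) c′≢c
    ; front′ = refl
    ; revisits = λ { (inj₁ hit) → inj₁ (AnyP.++⁺ˡ hit) } ; visits-q = inj₂ (here refl) }

  move : ∀ q l u w z → l ≢ zero → frontier u w ≢ just q → DistinctEnds u w → Move q l u w z
  move q l u (y ∷ w) z l≢0 u,w≢q distinct =
    enter-child q l u (y ∷ w) z l≢0 (u,w≢q ∘ cong just) u,w≢q distinct
  move q l u [] []     l≢0 u≢q   distinct = enter-child q l u [] [] l≢0 tt u≢q distinct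
  move q l u [] ((p , c) ∷ z) l≢0 u≢q distinct with p ≟ q
  ... | yes refl = leave-child p l c u z l≢0
  ... | no p≢q   = enter-child q l u [] ((p , c) ∷ z) l≢0 p≢q u≢q distinct

  -- σ₀ = u ++ z and steps r σ₀ = w ++ z with z their meet in the tree of cells;
  -- the frontier is the position of the face crossed last.
  record Gallery (σ₀ : Cell) (r : Word) : Set where
    field
      u w z    : Cell
      start    : σ₀ ≡ u ++ z
      end      : steps r σ₀ ≡ w ++ z
      distinct : DistinctEnds u w
      front    : frontier u w ≡ headLetter r
      visited  : ∀ {j} → Any (At j) r → Visits j u w

  gallery : ∀ σ₀ r → Reduced r → Gallery σ₀ r
  gallery σ₀ [] _ = record
    { u = [] ; w = [] ; z = σ₀ ; start = refl ; end = refl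
    ; distinct = λ _ → refl ; front = refl ; visited = λ () }
  gallery σ₀ ((q , l) ∷ r) (l≢0 , r≢q , reduced) = record
    { u = u′ ; w = w′ ; z = z′
    ; start = trans start same-start ; end = trans (cong (step q l) end) stepped
    ; distinct = distinct′ ; front = front′
    ; visited = λ { (here refl) → visits-q ; (there hit) → revisits (visited hit) } }
    where
    open Gallery (gallery σ₀ r reduced)
    open Move (move q l u w z l≢0 (r≢q ∘ trans (sym front)) distinct)

  steps-moves : ∀ σ₀ r → Reduced r → ∀ {j} → Any (At j) r → dropTo j σ₀ ≢ dropTo j (steps r σ₀)
  steps-moves σ₀ r reduced {j} hit same = dropTo-separates j u w z distinct (visited hit)
    (trans (cong (dropTo j) (sym start)) (trans same (cong (dropTo j) end)))
    where open Gallery (gallery σ₀ r reduced)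

module Orbit {d n : ℕ} (Γ : TDK.Coloring d (suc n)) (Ω : TDK.KOrdering d (suc n))
             (τ₀ : TDK.Cell d (suc n)) (τ₀-valid : TDK.ValidCell d (suc n) τ₀) where
  open TDK d (suc n)
  open Coloring Γ
  open Paths d (suc n)
  open Words d n
  open Steps Ω
  open ≡-Reasoning

  colourAt : Cell → Col → Col
  colourAt σ p = col (vertexAt σ p)

  colourAt-injective : ∀ σ → ValidCell σ → Injective _≡_ _≡_ (colourAt σ)
  colourAt-injective σ valid {p} {q} = inj σ valid p q

  colourAt-τ₀-injective : Injective _≡_ _≡_ (colourAt τ₀)
  colourAt-τ₀-injective = colourAt-injective τ₀ τ₀-valid

  position : Col → Col
  position i = proj₁ (Fin-injective⇒surjective colourAt-τ₀-injective i)

  colourAt-position : ∀ i → colourAt τ₀ (position i) ≡ i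
  colourAt-position i = proj₂ (Fin-injective⇒surjective colourAt-τ₀-injective i)

  position-injective : Injective _≡_ _≡_ position
  position-injective {i} {j} e =
    trans (sym (colourAt-position i)) (trans (cong (colourAt τ₀) e) (colourAt-position j))

  Aligned : Cell → Set
  Aligned σ = ValidCell σ × (∀ p → colourAt σ p ≡ colourAt τ₀ p)

  τ₀-aligned : Aligned τ₀
  τ₀-aligned = τ₀-valid , λ _ → refl

  -- The vertices off position p keep their colours, and the colouring of the new cell is a bijection.
  aligned-step : ∀ p l σ → Aligned σ → Aligned (step p l σ)
  aligned-step p l σ (valid , coloured) = valid′ , coloured′
    where
    σ′ = step p l σ
    valid′ = step-valid p l σ valid
    unmoved : ∀ q → q ≢ p → colourAt σ′ q ≡ colourAt τ₀ q
    unmoved q q≢p = trans (cong (λ b → col (q , b)) (dropTo-step q p l σ q≢p)) (coloured q)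
    coloured′ : ∀ q → colourAt σ′ q ≡ colourAt τ₀ q
    coloured′ q with q ≟ p
    ... | no q≢p = unmoved q q≢p
    ... | yes refl with q′ , e ← Fin-injective⇒surjective (colourAt-injective σ′ valid′) (colourAt τ₀ q)
                   with q′ ≟ q
    ...   | yes refl = e
    ...   | no q′≢q  = contradiction (colourAt-τ₀-injective (trans (sym (unmoved q′ q′≢q)) e)) q′≢q

  steps-aligned : ∀ w σ → Aligned σ → Aligned (steps w σ)
  steps-aligned []            σ aligned = aligned
  steps-aligned ((p , l) ∷ w) σ aligned = aligned-step p l (steps w σ) (steps-aligned w σ aligned)

  aligned-position : ∀ σ i → Aligned σ → colourAt σ (position i) ≡ i
  aligned-position σ i (_ , coloured) = trans (coloured (position i)) (colourAt-position i)

  findPos-aligned : ∀ σ i → Aligned σ → findPos Γ Ω σ i ≡ just (position i)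
  findPos-aligned σ i aligned@(valid , _) with any? (λ p → colourAt σ p ≟ i)
  ... | yes (p , e) = cong just (colourAt-injective σ valid (trans e (sym (aligned-position σ i aligned))))
  ... | no ∄p       = contradiction (position i , aligned-position σ i aligned) ∄p

  actSyl-aligned : ∀ i l σ → Aligned σ → actSyl Γ Ω (i , l) σ ≡ step (position i) l σ
  actSyl-aligned i l σ aligned rewrite findPos-aligned σ i aligned = refl

  actW-aligned : ∀ w σ → Aligned σ → actW Γ Ω w σ ≡ steps (relabel position w) σ
  actW-aligned []            σ aligned = refl
  actW-aligned ((i , l) ∷ w) σ aligned = begin
    actSyl Γ Ω (i , l) (actW Γ Ω w σ)        ≡⟨ cong (actSyl Γ Ω (i , l)) (actW-aligned w σ aligned) ⟩
    actSyl Γ Ω (i , l) (steps w′ σ)          ≡⟨ actSyl-aligned i l _ (steps-aligned w′ σ aligned) ⟩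
    step (position i) l (steps w′ σ)         ∎
    where w′ = relabel position w

  actW-++ : ∀ u v σ → actW Γ Ω (u ++ v) σ ≡ actW Γ Ω u (actW Γ Ω v σ)
  actW-++ []      v σ = refl
  actW-++ (s ∷ u) v σ = cong (actSyl Γ Ω s) (actW-++ u v σ)

  actW-++-cong : ∀ u {v v′} σ → actW Γ Ω v σ ≡ actW Γ Ω v′ σ →
                 actW Γ Ω (u ++ v) σ ≡ actW Γ Ω (u ++ v′) σ
  actW-++-cong u σ e = trans (actW-++ u _ σ) (trans (cong (actW Γ Ω u) e) (sym (actW-++ u _ σ)))

  actW-resp-Red : ∀ {w w′} → Red w w′ → ∀ σ → Aligned σ → actW Γ Ω w σ ≡ actW Γ Ω w′ σ
  actW-resp-Red (merge u v i a b) σ aligned = actW-++-cong u σ (begin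
      actW Γ Ω ((i , a) ∷ (i , b) ∷ v) σ          ≡⟨ actW-aligned ((i , a) ∷ (i , b) ∷ v) σ aligned ⟩
      step (position i) a (step (position i) b σᵥ) ≡⟨ step-merge (position i) a b σᵥ σᵥ-valid ⟩
      step (position i) (a +ₖ b) σᵥ               ≡⟨ actW-aligned ((i , a +ₖ b) ∷ v) σ aligned ⟨
      actW Γ Ω ((i , a +ₖ b) ∷ v) σ               ∎)
    where
    v′ = relabel position v
    σᵥ = steps v′ σ
    σᵥ-valid = proj₁ (steps-aligned v′ σ aligned)
  actW-resp-Red (unit u v i z z≡0) σ aligned with refl ← toℕ-injective {i = z} {j = zero} z≡0 =
    actW-++-cong u σ (begin
      actW Γ Ω ((i , zero) ∷ v) σ                ≡⟨ actW-aligned ((i , zero) ∷ v) σ aligned ⟩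
      step (position i) zero (steps v′ σ)         ≡⟨ step-zero (position i) (steps v′ σ) ⟩
      steps v′ σ                                  ≡⟨ actW-aligned v σ aligned ⟨
      actW Γ Ω v σ                                ∎)
    where v′ = relabel position v

  actW-resp-≈G : ∀ {w w′} → w ≈G w′ → actW Γ Ω w τ₀ ≡ actW Γ Ω w′ τ₀
  actW-resp-≈G =
    EqClosure.gfold isEquivalence (λ w → actW Γ Ω w τ₀) (λ red → actW-resp-Red red τ₀ τ₀-aligned)

  actW-by-steps : ∀ {g w} → g ≈G w → actW Γ Ω g τ₀ ≡ steps (relabel position w) τ₀
  actW-by-steps {w = w} g≈w = trans (actW-resp-≈G g≈w) (actW-aligned w τ₀ τ₀-aligned)

  module _ (S : Subset (suc d)) where

    Fixes : Cell → Set
    Fixes σ = ∀ j → j ∈ S → dropTo j σ ≡ dropTo j τ₀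

    ColorOf⇔position∈ : ∀ i → ColorOf Γ Ω τ₀ S i ⇔ position i ∈ S
    ColorOf⇔position∈ i = mk⇔
      (λ (j , j∈S , e) → subst (_∈ S) (colourAt-τ₀-injective (trans e (sym (colourAt-position i)))) j∈S)
      (λ p∈S → position i , p∈S , colourAt-position i)

    InL⇔Fixes : ∀ g → InL Γ Ω τ₀ S g ⇔ Fixes (actW Γ Ω g τ₀)
    InL⇔Fixes g = mk⇔ InL⇒Fixes Fixes⇒InL
      where
      σ = actW Γ Ω g τ₀
      σ-aligned : Aligned σ
      σ-aligned = subst Aligned (sym (actW-aligned g τ₀ τ₀-aligned))
                        (steps-aligned (relabel position g) τ₀ τ₀-aligned)
      InL⇒Fixes : InL Γ Ω τ₀ S g → Fixes σ
      InL⇒Fixes inL j j∈S with j′ , _ , e ← Equivalence.to (inL (vertexAt τ₀ j)) (j , j∈S , refl)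
                         with refl ← cong proj₁ e = cong proj₂ e
      Fixes⇒InL : Fixes σ → InL Γ Ω τ₀ S g
      Fixes⇒InL fixes v = mk⇔ to from
        where
        to : InCell Γ Ω τ₀ S v → CellOfColor Γ Ω σ (ColorOf Γ Ω τ₀ S) v
        to (j , j∈S , refl) = j , (j , j∈S , sym (proj₂ σ-aligned j)) , cong (j ,_) (fixes j j∈S)
        from : CellOfColor Γ Ω σ (ColorOf Γ Ω τ₀ S) v → InCell Γ Ω τ₀ S v
        from (j′ , (j , j∈S , e) , refl) with refl ← colourAt-τ₀-injective (trans e (proj₂ σ-aligned j′)) =
          j , j∈S , cong (j ,_) (sym (fixes j j∈S))

    InK⇒Fixes : ∀ g → InK (λ i → ¬ ColorOf Γ Ω τ₀ S i) g → Fixes (actW Γ Ω g τ₀)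
    InK⇒Fixes g (w , avoids , g≈w) j j∈S = begin
      dropTo j (actW Γ Ω g τ₀)                 ≡⟨ cong (dropTo j) (actW-by-steps g≈w) ⟩
      dropTo j (steps (relabel position w) τ₀) ≡⟨ steps-fix j _ τ₀ (AllP.map⁺ (All.map (λ {s} → misses-j {s}) avoids)) ⟩
      dropTo j τ₀                              ∎
      where
      misses-j : ∀ {s : Col × Fin (suc n)} → ¬ ColorOf Γ Ω τ₀ S (proj₁ s) → ¬ At j (map₁ position s)
      misses-j uncoloured refl = uncoloured (Equivalence.from (ColorOf⇔position∈ _) j∈S)

    Fixes⇒InK : ∀ g → Fixes (actW Γ Ω g τ₀) → InK (λ i → ¬ ColorOf Γ Ω τ₀ S i) g
    Fixes⇒InK g fixes = normalise g , AllP.¬Any⇒All¬ _ uncoloured , normalise-≈G g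
      where
      r = relabel position (normalise g)
      uncoloured : ¬ Any (ColorOf Γ Ω τ₀ S ∘ proj₁) (normalise g)
      uncoloured hit
        with j , j∈S , at-j ← Any-At (AnyP.map⁺ (Any.map (Equivalence.to (ColorOf⇔position∈ _)) hit)) =
        steps-moves τ₀ r (relabel-reduced position-injective _ (normalise-reduced g)) at-j (begin
          dropTo j τ₀              ≡⟨ fixes j j∈S ⟨
          dropTo j (actW Γ Ω g τ₀) ≡⟨ cong (dropTo j) (actW-by-steps (normalise-≈G g)) ⟩
          dropTo j (steps r τ₀)    ∎)

lemma5p11 : (d k : ℕ) → 1 ≤ d → 2 ≤ k →
    (Γ : TDK.Coloring d k) (Ω : TDK.KOrdering d k) →
    (τ : TDK.Cell d k) → TDK.ValidCell d k τ → (S : Subset (suc d)) →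
    (g : TDK.Word d k) →
    TDK.InL d k Γ Ω τ S g ⇔ TDK.InK d k (λ j → ¬ TDK.ColorOf d k Γ Ω τ S j) g
lemma5p11 d .(suc n) _ (s≤s {n = n} _) Γ Ω τ τ-valid S g =
  mk⇔ (Fixes⇒InK S g ∘ Equivalence.to (InL⇔Fixes S g))
      (Equivalence.from (InL⇔Fixes S g) ∘ InK⇒Fixes S g)
  where open Orbit Γ Ω τ τ-valid
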